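{- In the primal-dual version of GreedyDual described in the context, for every integer $h$ with $1\le h\le k$, after each request is processed the total distance $D$ traveled by servers so far satisfies \[D\le \frac{k}{k-h+1}\|(a,b)\|_h-\sum_{i\in S} b_{i^-+1},\] where the sum is over the multiset $S$ (with multiplicity) and $b_{N+1}:=0$.
   Context: Weighted caching: nodes $v$ have nonnegative weights $w(v)$, and the distance is $d(u,v)=w(u)$ for $u\ne v$, $d(u,u)=0$. Fix a request sequence $r_0,r_1,\dots,r_N$ of nodes, where $r_0$ is an artificial node with $w(r_0)=0$ that is never requested again. There are $k\ge1$ servers. Dual program $\mathrm{DP}(h)$: variables $a_0,\dots,a_{N-1}$ and $b_1,\dots,b_N$; maximize $\|(a,b)\|_h=-h a_0-\sum_{i=1}^{N-1}a_i+\sum_{i=1}^N b_i$ subject to $b_j-a_i\le d(r_i,r_j)$ for all $0\le i<j\le N$, and $a_i\ge 0$ for all $i$. Primal-dual GreedyDual with $k$ servers: it maintains $(a,b)$, a multiset $S$ of request indices of size $k$ (the requests that currently "have a server"), for each $i\in S$ an index $i^-\le i$ (the most recent request, up to and including $i$, at which the server of request $i$ moved), and the total distance $D$ traveled. Initially all $a_i,b_i$ equal $0$, $D=0$, $S$ consists of $0$ with multiplicity $k$, and $0^-=0$. For each $n=1,\dots,N$: (Stay) if some $i\in S$ has $r_i=r_n$, choose such $i$, replace one copy of $i$ in $S$ by $n$, and set $n^-=i^-$. Otherwise: (Relabel) raise by one common amount $\delta\ge0$ every $a_i$ with $0\le i\le n-1$, $i\notin S$, and every $b_i$ with $1\le i\le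 n$, where $\delta$ is chosen so that afterwards $b_{i+1}\le w(r_i)$ for all $i\in S$ and $b_{i^-+1}\ge w(r_i)$ for some $i\in S$; (Move) choose $i\in S$ with $b_{i^-+1}\ge w(r_i)$, replace one copy of $i$ in $S$ by $n$, set $n^-=n$, and increase $D$ by $d(r_i,r_n)=w(r_i)$.
   Formalization: The node weights $w(v)$ and the relabel amounts δ are rational instead of real. -}

module Defs where

open import Data.Nat as ℕ using (ℕ; zero; suc; _∸_; _<ᵇ_; _≡ᵇ_)
open import Data.Bool using (Bool; true; false; if_then_else_; _∧_; not; _∨_)
open import Data.Integer using (+_)
open import Data.Rational using (ℚ; 0ℚ; _+_; _-_; _*_; _≤_; _/_)
open import Data.Fin using (Fin)
open import Data.Vec using (Vec; lookup; replicate; _[_]≔_; foldr)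
open import Data.List using (List; upTo; map)
import Data.List as L
open import Data.Product using (Σ; ∃; _×_)
open import Relation.Binary.PropositionalEquality using (_≡_; _≢_)

sumℚ : List ℚ → ℚ
sumℚ = L.foldr _+_ 0ℚ

Σ₁ : ℕ → (ℕ → ℚ) → ℚ
Σ₁ m f = sumℚ (map (λ i → f (suc i)) (upTo m))

memᵇ : ∀ {k} → ℕ → Vec ℕ k → Bool
memᵇ i S = foldr (λ _ → Bool) (λ j acc → (i ≡ᵇ j) ∨ acc) false S

-- S is the multiset of request indices having a server,
-- represented as a vector of length k (one entry per server, so repetitions
-- give multiplicities); minus i is i^-; D the total distance so far.
record State (k : ℕ) : Set where
  constructor st
  field
    a     : ℕ → ℚ
    b     : ℕ → ℚ
    S     : Vec ℕ k
    minus : ℕ → ℕ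
    D     : ℚ
open State public

initState : (k : ℕ) → State k
initState k = st (λ _ → 0ℚ) (λ _ → 0ℚ) (replicate k 0) (λ _ → 0) 0ℚ

setMinus : (ℕ → ℕ) → ℕ → ℕ → (ℕ → ℕ)
setMinus m n v i = if i ≡ᵇ n then v else m i

raiseA : ∀ {k} → ℕ → Vec ℕ k → ℚ → (ℕ → ℚ) → (ℕ → ℚ)
raiseA n S δ a i = if (i <ᵇ n) ∧ not (memᵇ i S) then a i + δ else a i

raiseB : ℕ → ℚ → (ℕ → ℚ) → (ℕ → ℚ)
raiseB n δ b i = if (0 <ᵇ i) ∧ (i <ᵇ suc n) then b i + δ else b i

data Step {V : Set} (w : V → ℚ) (r : ℕ → V) (k : ℕ) (n : ℕ) (s : State k) : State k → Set where
  stay : (p : Fin k) → r (lookup (S s) p) ≡ r n →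
         Step w r k n s
           (st (a s) (b s) (S s [ p ]≔ n)
               (setMinus (minus s) n (minus s (lookup (S s) p))) (D s))
  relabelMove :
         (∀ (q : Fin k) → r (lookup (S s) q) ≢ r n) →
         (δ : ℚ) → 0ℚ ≤ δ →
         (∀ (q : Fin k) → raiseB n δ (b s) (suc (lookup (S s) q)) ≤ w (r (lookup (S s) q))) →
         (∃ λ (q : Fin k) → w (r (lookup (S s) q)) ≤ raiseB n δ (b s) (suc (minus s (lookup (S s) q)))) →
         (p : Fin k) → w (r (lookup (S s) p)) ≤ raiseB n δ (b s) (suc (minus s (lookup (S s) p))) →
         Step w r k n s
           (st (raiseA n (S s) δ (a s)) (raiseB n δ (b s)) (S s [ p ]≔ n)
               (setMinus (minus s) n n)
               -- d(r_i, r_n) = w(r_i) since r_i ≠ r_n here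
               (D s + w (r (lookup (S s) p))))

data Run {V : Set} (w : V → ℚ) (r : ℕ → V) (k : ℕ) : ℕ → State k → Set where
  init : Run w r k 0 (initState k)
  next : ∀ {n s s'} → Run w r k n s → Step w r k (suc n) s s' → Run w r k (suc n) s'

dualNorm : ℕ → ℕ → (ℕ → ℚ) → (ℕ → ℚ) → ℚ
dualNorm N h a b = ((0ℚ - (+ h / 1) * a 0) - Σ₁ (N ∸ 1) a) + Σ₁ N b

sumS : ∀ {k} → State k → ℚ
sumS {k} s = foldr (λ _ → ℚ) (λ i acc → b s (suc (minus s i)) + acc) 0ℚ (S s)

-- The bound is an invariant of the run.  A Stay step changes nothing that
-- occurs in it.  In a Relabel step by δ with r₀ served, the server at r₀
-- forces δ = 0.  Otherwise S consists of k distinct requests among 1 … n-1,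
-- so the relabelling raises n of the bᵢ and n - 1 - k of the aᵢ (i ≥ 1)
-- together with a₀: the dual norm grows by (k - h + 1)δ, and k/(k-h+1) times
-- this is kδ, which is exactly the growth of the k summands b_{i⁻+1}.  The
-- Move then trades the summand b_{i⁻+1} ≥ w(rᵢ) of the moving server for
-- b_{n+1} = 0, which pays for the distance w(rᵢ) that is travelled.
module Submission where

open import Defs
open import Data.Nat using (ℕ; suc; _∸_; _≤_)
open import Data.Integer using (+_)
open import Data.Rational using (ℚ; 0ℚ; _-_; _*_; _/_) renaming (_≤_ to _≤ℚ_)
open import Relation.Binary.PropositionalEquality using (_≡_; _≢_)

open import Data.Bool using (Bool; true; false; T; not; _∧_; _∨_; if_then_else_)
open import Data.Bool.Properties using (T-∨)
open import Data.Empty using (⊥; ⊥-elim)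
open import Data.Fin using (Fin; zero; suc)
import Data.Fin.Properties as Fin
import Data.Integer as ℤ
import Data.Integer.Properties as ℤ
open import Data.List using (List; []; _∷_; map; upTo)
import Data.List.Properties as List
open import Data.Nat using (zero; _<_; _<ᵇ_; _≡ᵇ_; z≤n; s≤s)
import Data.Nat as ℕ
import Data.Nat.Properties as ℕ
open import Data.Product using (∃; _×_; _,_)
open import Data.Rational using (_+_; toℚᵘ)
import Data.Rational.Properties as ℚ
open import Data.Rational.Solver using (module +-*-Solver)
import Data.Rational.Unnormalised as ℚᵘ
import Data.Rational.Unnormalised.Properties as ℚᵘ
open import Data.Sum using (_⊎_; inj₁; inj₂)
open import Data.Vec using (Vec; []; _∷_; lookup; replicate; _[_]≔_; foldr)
import Data.Vec.Properties as Vec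
open import Function.Bundles using (Equivalence)
open import Function.Definitions using (Injective)
open import Relation.Nullary using (¬_; yes; no)
open import Relation.Nullary.Decidable using (T?)
open import Relation.Binary.PropositionalEquality
  using (refl; sym; trans; cong; cong₂; subst; subst₂; module ≡-Reasoning)

open +-*-Solver

private
  variable
    A : Set
    k n : ℕ

fromℕ : ℕ → ℚ
fromℕ n = + n / 1

toℚᵘ-fromℕ : ∀ n → toℚᵘ (fromℕ n) ℚᵘ.≃ ℚᵘ.mkℚᵘ (+ n) 0
toℚᵘ-fromℕ n = ℚ.toℚᵘ-fromℚᵘ (ℚᵘ.mkℚᵘ (+ n) 0)

fromℕ-+ : ∀ m n → fromℕ (m ℕ.+ n) ≡ fromℕ m + fromℕ n
fromℕ-+ m n = ℚ.toℚᵘ-injective (begin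
    toℚᵘ (fromℕ (m ℕ.+ n))                  ≈⟨ toℚᵘ-fromℕ (m ℕ.+ n) ⟩
    ℚᵘ.mkℚᵘ (+ (m ℕ.+ n)) 0                 ≈⟨ ℚᵘ.*≡* cross ⟩
    ℚᵘ.mkℚᵘ (+ m) 0 ℚᵘ.+ ℚᵘ.mkℚᵘ (+ n) 0    ≈⟨ ℚᵘ.+-cong (toℚᵘ-fromℕ m) (toℚᵘ-fromℕ n) ⟨
    toℚᵘ (fromℕ m) ℚᵘ.+ toℚᵘ (fromℕ n)      ≈⟨ ℚ.toℚᵘ-homo-+ (fromℕ m) (fromℕ n) ⟨
    toℚᵘ (fromℕ m + fromℕ n)                ∎)
  where
  open ℚᵘ.≃-Reasoning
  cross : + (m ℕ.+ n) ℤ.* + 1 ≡ (+ m ℤ.* + 1 ℤ.+ + n ℤ.* + 1) ℤ.* + 1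
  cross = trans (ℤ.*-identityʳ _) (trans (ℤ.pos-+ m n) (sym (trans (ℤ.*-identityʳ _)
            (cong₂ ℤ._+_ (ℤ.*-identityʳ (+ m)) (ℤ.*-identityʳ (+ n))))))

n/d*d≡n : ∀ n d → (+ n / suc d) * fromℕ (suc d) ≡ fromℕ n
n/d*d≡n n d = ℚ.toℚᵘ-injective (begin
    toℚᵘ ((+ n / suc d) * fromℕ (suc d))          ≈⟨ ℚ.toℚᵘ-homo-* (+ n / suc d) (fromℕ (suc d)) ⟩
    toℚᵘ (+ n / suc d) ℚᵘ.* toℚᵘ (fromℕ (suc d))
      ≈⟨ ℚᵘ.*-cong (ℚ.toℚᵘ-fromℚᵘ (ℚᵘ.mkℚᵘ (+ n) d)) (toℚᵘ-fromℕ (suc d)) ⟩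
    ℚᵘ.mkℚᵘ (+ n) d ℚᵘ.* ℚᵘ.mkℚᵘ (+ suc d) 0
      ≈⟨ ℚᵘ.*≡* (trans (ℤ.*-identityʳ _) (cong (+ n ℤ.*_) (sym (ℤ.*-identityʳ _)))) ⟩
    ℚᵘ.mkℚᵘ (+ n) 0                               ≈⟨ toℚᵘ-fromℕ n ⟨
    toℚᵘ (fromℕ n)                                ∎)
  where open ℚᵘ.≃-Reasoning

if-T : ∀ {b} {x y : A} → T b → (if b then x else y) ≡ x
if-T {b = true} _ = refl

if-¬T : ∀ {b} {x y : A} → ¬ T b → (if b then x else y) ≡ y
if-¬T {b = false} _ = refl
if-¬T {b = true} ¬t = ⊥-elim (¬t _)

fromBool : Bool → ℕ
fromBool true = 1
fromBool false = 0

countᵇ : (A → Bool) → List A → ℕ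
countᵇ P [] = 0
countᵇ P (x ∷ xs) = fromBool (P x) ℕ.+ countᵇ P xs

countᵇ-false : (xs : List A) → countᵇ (λ _ → false) xs ≡ 0
countᵇ-false [] = refl
countᵇ-false (x ∷ xs) = countᵇ-false xs

countᵇ-map : ∀ {B : Set} (P : B → Bool) (f : A → B) xs → countᵇ P (map f xs) ≡ countᵇ (λ x → P (f x)) xs
countᵇ-map P f [] = refl
countᵇ-map P f (x ∷ xs) = cong (fromBool (P (f x)) ℕ.+_) (countᵇ-map P f xs)

countᵇ-upTo-suc : ∀ P n → countᵇ P (upTo (suc n)) ≡ fromBool (P 0) ℕ.+ countᵇ (λ i → P (suc i)) (upTo n)
countᵇ-upTo-suc P n =
  cong (fromBool (P 0) ℕ.+_) (trans (cong (countᵇ P) (sym (List.map-upTo suc n))) (countᵇ-map P suc (upTo n)))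

countᵇ-∨ : ∀ {P Q : A → Bool} → (∀ x → T (P x) → T (Q x) → ⊥) →
           ∀ xs → countᵇ (λ x → P x ∨ Q x) xs ≡ countᵇ P xs ℕ.+ countᵇ Q xs
countᵇ-∨ disjoint [] = refl
countᵇ-∨ {P = P} {Q} disjoint (x ∷ xs) with P x | Q x | disjoint x
... | true  | true  | d = ⊥-elim (d _ _)
... | true  | false | _ = cong suc (countᵇ-∨ disjoint xs)
... | false | true  | _ = trans (cong suc (countᵇ-∨ disjoint xs)) (sym (ℕ.+-suc _ _))
... | false | false | _ = countᵇ-∨ disjoint xs

countᵇ-∧-not : ∀ {P Q : A → Bool} → (∀ x → T (Q x) → T (P x)) →
               ∀ xs → countᵇ (λ x → P x ∧ not (Q x)) xs ℕ.+ countᵇ Q xs ≡ countᵇ P xs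
countᵇ-∧-not Q⇒P [] = refl
countᵇ-∧-not {P = P} {Q} Q⇒P (x ∷ xs) with P x | Q x | Q⇒P x
... | true  | true  | _ = trans (ℕ.+-suc _ _) (cong suc (countᵇ-∧-not Q⇒P xs))
... | true  | false | _ = cong suc (countᵇ-∧-not Q⇒P xs)
... | false | true  | q⇒p = ⊥-elim (q⇒p _)
... | false | false | _ = countᵇ-∧-not Q⇒P xs

countᵇ-upTo-< : ∀ {n L} → n ≤ L → countᵇ (_<ᵇ n) (upTo L) ≡ n
countᵇ-upTo-< {zero} {L} _ = countᵇ-false (upTo L)
countᵇ-upTo-< {suc n} {suc L} (s≤s n≤L) =
  trans (countᵇ-upTo-suc (_<ᵇ suc n) L) (cong suc (countᵇ-upTo-< n≤L))

countᵇ-upTo-≡ : ∀ {y L} → y < L → countᵇ (_≡ᵇ y) (upTo L) ≡ 1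
countᵇ-upTo-≡ {zero} {suc L} _ =
  trans (countᵇ-upTo-suc (_≡ᵇ 0) L) (cong suc (countᵇ-false (upTo L)))
countᵇ-upTo-≡ {suc y} {suc L} (s≤s y<L) =
  trans (countᵇ-upTo-suc (_≡ᵇ suc y) L) (countᵇ-upTo-≡ y<L)

memᵇ-sound : ∀ i (V : Vec ℕ k) → T (memᵇ i V) → ∃ λ q → lookup V q ≡ i
memᵇ-sound i (x ∷ V) i∈ with Equivalence.to T-∨ i∈
... | inj₁ i≡x = zero , sym (ℕ.≡ᵇ⇒≡ i x i≡x)
... | inj₂ i∈V with memᵇ-sound i V i∈V
...   | q , eq = suc q , eq

memᵇ-lookup : (V : Vec ℕ k) (q : Fin k) → T (memᵇ (lookup V q) V)
memᵇ-lookup (x ∷ V) zero = Equivalence.from T-∨ (inj₁ (ℕ.≡⇒≡ᵇ x x refl))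
memᵇ-lookup (x ∷ V) (suc q) = Equivalence.from T-∨ (inj₂ (memᵇ-lookup V q))

countᵇ-memᵇ : ∀ {L} (V : Vec ℕ k) → (∀ q → 0 < lookup V q) → (∀ q → lookup V q ≤ L) →
              Injective _≡_ _≡_ (lookup V) → countᵇ (λ i → memᵇ (suc i) V) (upTo L) ≡ k
countᵇ-memᵇ {L = L} [] _ _ _ = countᵇ-false (upTo L)
countᵇ-memᵇ (zero ∷ V) positive _ _ with positive zero
... | ()
countᵇ-memᵇ {L = L} (suc y ∷ V) positive bounded injective =
  trans (countᵇ-∨ disjoint (upTo L))
        (cong₂ ℕ._+_ (countᵇ-upTo-≡ (bounded zero))
                     (countᵇ-memᵇ V (λ q → positive (suc q)) (λ q → bounded (suc q))
                                  (λ eq → Fin.suc-injective (injective eq))))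
  where
  disjoint : ∀ i → T (i ≡ᵇ y) → T (memᵇ (suc i) V) → ⊥
  disjoint i i≡y i∈V with memᵇ-sound (suc i) V i∈V
  ... | q , eq with injective {suc q} {zero} (trans eq (cong suc (ℕ.≡ᵇ⇒≡ i y i≡y)))
  ...   | ()

sumℚ-zeros : (xs : List A) → sumℚ (map (λ _ → 0ℚ) xs) ≡ 0ℚ
sumℚ-zeros [] = refl
sumℚ-zeros (x ∷ xs) = cong (_+_ 0ℚ) (sumℚ-zeros xs)

raise-if : ∀ c x δ → (if c then x + δ else x) ≡ x + fromℕ (fromBool c) * δ
raise-if true x δ = cong (_+_ x) (sym (ℚ.*-identityˡ δ))
raise-if false x δ = sym (trans (cong (_+_ x) (ℚ.*-zeroˡ δ)) (ℚ.+-identityʳ x))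

sumℚ-raise : ∀ (P : A → Bool) f δ xs →
  sumℚ (map (λ x → if P x then f x + δ else f x) xs) ≡ sumℚ (map f xs) + fromℕ (countᵇ P xs) * δ
sumℚ-raise P f δ [] = sym (trans (cong (_+_ 0ℚ) (ℚ.*-zeroˡ δ)) (ℚ.+-identityʳ 0ℚ))
sumℚ-raise P f δ (x ∷ xs) = begin
    (if P x then f x + δ else f x) + sumℚ (map (λ x → if P x then f x + δ else f x) xs)
  ≡⟨ cong₂ _+_ (raise-if (P x) (f x) δ) (sumℚ-raise P f δ xs) ⟩
    (f x + fromℕ c * δ) + (sumℚ (map f xs) + fromℕ cs * δ)
  ≡⟨ solve 5 (λ y c s cs d → (y :+ c :* d) :+ (s :+ cs :* d) := (y :+ s) :+ (c :+ cs) :* d)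
           refl (f x) (fromℕ c) (sumℚ (map f xs)) (fromℕ cs) δ ⟩
    (f x + sumℚ (map f xs)) + (fromℕ c + fromℕ cs) * δ
  ≡⟨ cong (λ t → (f x + sumℚ (map f xs)) + t * δ) (fromℕ-+ c cs) ⟨
    (f x + sumℚ (map f xs)) + fromℕ (c ℕ.+ cs) * δ
  ∎
  where
  open ≡-Reasoning
  c = fromBool (P x)
  cs = countᵇ P xs

sumᵛ : (ℕ → ℚ) → Vec ℕ k → ℚ
sumᵛ f = foldr (λ _ → ℚ) (λ i acc → f i + acc) 0ℚ

sumᵛ-zeros : (V : Vec ℕ k) → sumᵛ (λ _ → 0ℚ) V ≡ 0ℚ
sumᵛ-zeros [] = refl
sumᵛ-zeros (x ∷ V) = cong (_+_ 0ℚ) (sumᵛ-zeros V)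

sumᵛ-cong : ∀ {f g} (V : Vec ℕ k) → (∀ q → f (lookup V q) ≡ g (lookup V q)) → sumᵛ f V ≡ sumᵛ g V
sumᵛ-cong [] _ = refl
sumᵛ-cong {f = f} {g} (x ∷ V) f≡g = cong₂ _+_ (f≡g zero) (sumᵛ-cong {f = f} {g} V (λ q → f≡g (suc q)))

sumᵛ-+δ : ∀ f δ (V : Vec ℕ k) → sumᵛ (λ i → f i + δ) V ≡ sumᵛ f V + fromℕ k * δ
sumᵛ-+δ f δ [] = sym (trans (cong (_+_ 0ℚ) (ℚ.*-zeroˡ δ)) (ℚ.+-identityʳ 0ℚ))
sumᵛ-+δ {suc k} f δ (x ∷ V) = begin
    (f x + δ) + sumᵛ (λ i → f i + δ) V
  ≡⟨ cong (_+_ (f x + δ)) (sumᵛ-+δ f δ V) ⟩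
    (f x + δ) + (sumᵛ f V + fromℕ k * δ)
  ≡⟨ solve 4 (λ y s c d → (y :+ d) :+ (s :+ c :* d) := (y :+ s) :+ (con (fromℕ 1) :+ c) :* d)
           refl (f x) (sumᵛ f V) (fromℕ k) δ ⟩
    (f x + sumᵛ f V) + (fromℕ 1 + fromℕ k) * δ
  ≡⟨ cong (λ t → (f x + sumᵛ f V) + t * δ) (fromℕ-+ 1 k) ⟨
    (f x + sumᵛ f V) + fromℕ (suc k) * δ
  ∎
  where open ≡-Reasoning

sumᵛ-[]≔ : ∀ f (V : Vec ℕ k) p x → sumᵛ f (V [ p ]≔ x) ≡ (sumᵛ f V - f (lookup V p)) + f x
sumᵛ-[]≔ f (y ∷ V) zero x =
  solve 3 (λ x s y → x :+ s := ((y :+ s) :- y) :+ x) refl (f x) (sumᵛ f V) (f y)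
sumᵛ-[]≔ f (y ∷ V) (suc p) x = begin
    f y + sumᵛ f (V [ p ]≔ x)
  ≡⟨ cong (_+_ (f y)) (sumᵛ-[]≔ f V p x) ⟩
    f y + ((sumᵛ f V - f (lookup V p)) + f x)
  ≡⟨ solve 4 (λ y s z x → y :+ ((s :- z) :+ x) := ((y :+ s) :- z) :+ x)
           refl (f y) (sumᵛ f V) (f (lookup V p)) (f x) ⟩
    ((f y + sumᵛ f V) - f (lookup V p)) + f x
  ∎
  where open ≡-Reasoning

lookup-[]≔ : ∀ (V : Vec A k) p x q →
             (q ≡ p × lookup (V [ p ]≔ x) q ≡ x) ⊎ lookup (V [ p ]≔ x) q ≡ lookup V q
lookup-[]≔ V p x q with q Fin.≟ p
... | yes refl = inj₁ (refl , Vec.lookup∘update p V x)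
... | no q≢p = inj₂ (Vec.lookup∘update′ q≢p V x)

NonzeroDistinct : Vec ℕ k → Set
NonzeroDistinct V = ∀ p q → lookup V p ≡ lookup V q → lookup V p ≡ 0 ⊎ p ≡ q

[]≔-fresh-bounded : ∀ (V : Vec ℕ k) p → (∀ q → lookup V q ≤ n) → ∀ q → lookup (V [ p ]≔ suc n) q ≤ suc n
[]≔-fresh-bounded V p bounded q with lookup-[]≔ V p _ q
... | inj₁ (_ , eq) = ℕ.≤-reflexive eq
... | inj₂ eq = subst (_≤ _) (sym eq) (ℕ.m≤n⇒m≤1+n (bounded q))

[]≔-fresh-nonzeroDistinct : ∀ (V : Vec ℕ k) p → (∀ q → lookup V q ≤ n) →
                            NonzeroDistinct V → NonzeroDistinct (V [ p ]≔ suc n)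
[]≔-fresh-nonzeroDistinct V p bounded distinct q₁ q₂ eq
  with lookup-[]≔ V p _ q₁ | lookup-[]≔ V p _ q₂
... | inj₁ (refl , _) | inj₁ (refl , _) = inj₂ refl
... | inj₁ (_ , e₁) | inj₂ e₂ =
  ⊥-elim (ℕ.<-irrefl (trans (sym e₂) (trans (sym eq) e₁)) (s≤s (bounded q₂)))
... | inj₂ e₁ | inj₁ (_ , e₂) =
  ⊥-elim (ℕ.<-irrefl (trans (sym e₁) (trans eq e₂)) (s≤s (bounded q₁)))
... | inj₂ e₁ | inj₂ e₂ with distinct q₁ q₂ (trans (sym e₁) (trans eq e₂))
...   | inj₁ zero-entry = inj₁ (trans e₁ zero-entry)
...   | inj₂ q₁≡q₂ = inj₂ q₁≡q₂

setMinus-here : ∀ m n v → setMinus m n v n ≡ v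
setMinus-here m n v = if-T (ℕ.≡⇒≡ᵇ n n refl)

setMinus-there : ∀ m {n} v {i} → i < n → setMinus m n v i ≡ m i
setMinus-there m v {i} i<n = if-¬T (λ i≡n → ℕ.<⇒≢ i<n (ℕ.≡ᵇ⇒≡ i _ i≡n))

raiseB-raised : ∀ n δ b {i} → 1 ≤ i → i ≤ n → raiseB n δ b i ≡ b i + δ
raiseB-raised n δ b {suc i} _ i<n = if-T (ℕ.<⇒<ᵇ i<n)

raiseB-beyond : ∀ n δ b {i} → n < i → raiseB n δ b i ≡ b i
raiseB-beyond n δ b {suc i} (s≤s n≤i) = if-¬T (λ i<n → ℕ.≤⇒≯ n≤i (ℕ.<ᵇ⇒< i n i<n))

raiseB-nonneg : ∀ n {δ b} → 0ℚ ≤ℚ δ → (∀ i → 0ℚ ≤ℚ b i) → ∀ i → 0ℚ ≤ℚ raiseB n δ b i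
raiseB-nonneg n {δ} {b} 0≤δ 0≤b i with (0 <ᵇ i) ∧ (i <ᵇ suc n)
... | true = subst (_≤ℚ b i + δ) (ℚ.+-identityʳ 0ℚ) (ℚ.+-mono-≤ (0≤b i) 0≤δ)
... | false = 0≤b i

dualNormSlope : ℕ → ℕ → ℕ → Vec ℕ k → ℚ
dualNormSlope N h n S =
  (fromℕ (countᵇ (_<ᵇ n) (upTo N))
    - fromℕ (countᵇ (λ i → (suc i <ᵇ n) ∧ not (memᵇ (suc i) S)) (upTo (N ∸ 1))))
    - fromℕ h * fromℕ (fromBool ((0 <ᵇ n) ∧ not (memᵇ 0 S)))

dualNorm-raise : ∀ N h n (S : Vec ℕ k) δ a b →
  dualNorm N h (raiseA n S δ a) (raiseB n δ b) ≡ dualNorm N h a b + dualNormSlope N h n S * δ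
dualNorm-raise N h n S δ a b = begin
    ((0ℚ - H * raiseA n S δ a 0) - Σ₁ (N ∸ 1) (raiseA n S δ a)) + Σ₁ N (raiseB n δ b)
  ≡⟨ cong₂ _+_ (cong₂ _-_ (cong (λ t → 0ℚ - H * t) (raise-if (A₀) (a 0) δ))
                          (sumℚ-raise Aₛ (λ i → a (suc i)) δ (upTo (N ∸ 1))))
               (sumℚ-raise (_<ᵇ n) (λ i → b (suc i)) δ (upTo N)) ⟩
    ((0ℚ - H * (a 0 + z * δ)) - (Σ₁ (N ∸ 1) a + ca * δ)) + (Σ₁ N b + cb * δ)
  ≡⟨ solve 8 (λ H a₀ z d Σa ca Σb cb →
                ((con 0ℚ :- H :* (a₀ :+ z :* d)) :- (Σa :+ ca :* d)) :+ (Σb :+ cb :* d)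
                := (((con 0ℚ :- H :* a₀) :- Σa) :+ Σb) :+ ((cb :- ca) :- H :* z) :* d)
           refl H (a 0) z δ (Σ₁ (N ∸ 1) a) ca (Σ₁ N b) cb ⟩
    dualNorm N h a b + dualNormSlope N h n S * δ
  ∎
  where
  open ≡-Reasoning
  H = fromℕ h
  A₀ = (0 <ᵇ n) ∧ not (memᵇ 0 S)
  Aₛ = λ i → (suc i <ᵇ n) ∧ not (memᵇ (suc i) S)
  z = fromℕ (fromBool A₀)
  ca = fromℕ (countᵇ Aₛ (upTo (N ∸ 1)))
  cb = fromℕ (countᵇ (_<ᵇ n) (upTo N))

-- With r₀ unserved, S holds k distinct requests among 1 … n, so the relabelling
-- for request n + 1 raises a₀, n - k further aᵢ and n + 1 of the bᵢ.
dualNormSlope-unserved : ∀ {N h} → h ≤ k → suc n ≤ N → (S : Vec ℕ k) →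
  (∀ q → 0 < lookup S q) → (∀ q → lookup S q ≤ n) → Injective _≡_ _≡_ (lookup S) →
  dualNormSlope N h (suc n) S ≡ fromℕ (suc (k ∸ h))
dualNormSlope-unserved {k} {n} {N} {h} h≤k n<N S positive bounded injective = begin
    (fromℕ (countᵇ (_<ᵇ suc n) (upTo N)) - fromℕ ca) - fromℕ h * fromℕ (fromBool (not (memᵇ 0 S)))
  ≡⟨ cong₂ (λ cb z → (fromℕ cb - fromℕ ca) - fromℕ h * fromℕ (fromBool (not z)))
           (trans (countᵇ-upTo-< n<N) cb≡ca+j+h) r₀∉S ⟩
    (fromℕ (ca ℕ.+ (suc (k ∸ h) ℕ.+ h)) - fromℕ ca) - fromℕ h * fromℕ 1
  ≡⟨ cong (λ t → (t - fromℕ ca) - fromℕ h * fromℕ 1)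
          (trans (fromℕ-+ ca _) (cong (_+_ (fromℕ ca)) (fromℕ-+ (suc (k ∸ h)) h))) ⟩
    (fromℕ ca + (fromℕ (suc (k ∸ h)) + fromℕ h)) - fromℕ ca - fromℕ h * fromℕ 1
  ≡⟨ solve 3 (λ c j h → ((c :+ (j :+ h)) :- c) :- h :* con (fromℕ 1) := j)
           refl (fromℕ ca) (fromℕ (suc (k ∸ h))) (fromℕ h) ⟩
    fromℕ (suc (k ∸ h))
  ∎
  where
  open ≡-Reasoning
  L = N ∸ 1
  n≤L : n ≤ L
  n≤L = ℕ.∸-monoˡ-≤ 1 n<N
  ca = countᵇ (λ i → (i <ᵇ n) ∧ not (memᵇ (suc i) S)) (upTo L)
  served⇒<n : ∀ i → T (memᵇ (suc i) S) → T (i <ᵇ n)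
  served⇒<n i i∈S with memᵇ-sound (suc i) S i∈S
  ... | q , eq = ℕ.<⇒<ᵇ (subst (_≤ n) eq (bounded q))
  ca+k≡n : ca ℕ.+ k ≡ n
  ca+k≡n = begin
    ca ℕ.+ k
      ≡⟨ cong (ca ℕ.+_) (countᵇ-memᵇ S positive (λ q → ℕ.≤-trans (bounded q) n≤L) injective) ⟨
    ca ℕ.+ countᵇ (λ i → memᵇ (suc i) S) (upTo L)  ≡⟨ countᵇ-∧-not served⇒<n (upTo L) ⟩
    countᵇ (_<ᵇ n) (upTo L)                        ≡⟨ countᵇ-upTo-< n≤L ⟩
    n                                              ∎
  cb≡ca+j+h : suc n ≡ ca ℕ.+ (suc (k ∸ h) ℕ.+ h)
  cb≡ca+j+h = begin
    suc n                          ≡⟨ cong suc ca+k≡n ⟨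
    suc (ca ℕ.+ k)                 ≡⟨ ℕ.+-suc ca k ⟨
    ca ℕ.+ suc k                   ≡⟨ cong (λ t → ca ℕ.+ suc t) (ℕ.m∸n+n≡m h≤k) ⟨
    ca ℕ.+ (suc (k ∸ h) ℕ.+ h)     ∎
  r₀∉S : memᵇ 0 S ≡ false
  r₀∉S with memᵇ 0 S in eq
  ... | false = refl
  ... | true with memᵇ-sound 0 S (subst T (sym eq) _)
  ...   | q , Sq≡0 = ⊥-elim (ℕ.<-irrefl (sym Sq≡0) (positive q))

rhs-after-move : ∀ c ν σ γ {ξ κ} → c * ξ ≡ κ →
  c * (ν + ξ) - (((σ + κ) - γ) + 0ℚ) ≡ (c * ν - σ) + γ
rhs-after-move c ν σ γ {ξ} refl =
  solve 5 (λ c ν ξ σ γ → c :* (ν :+ ξ) :- (((σ :+ c :* ξ) :- γ) :+ con 0ℚ) := (c :* ν :- σ) :+ γ)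
        refl c ν ξ σ γ

b⁻ : State k → ℕ → ℚ
b⁻ s i = b s (suc (minus s i))

module GreedyDual {V : Set} (w : V → ℚ) (r : ℕ → V) (w-r₀ : w (r 0) ≡ 0ℚ) (N k h : ℕ) (h≤k : h ≤ k) where

  ratio : ℚ
  ratio = + k / suc (k ∸ h)

  record Invariant (n : ℕ) (s : State k) : Set where
    field
      S-bounded       : ∀ q → lookup (S s) q ≤ n
      minus-bounded   : ∀ q → minus s (lookup (S s) q) ≤ n
      S-distinct      : NonzeroDistinct (S s)
      b-nonneg        : ∀ i → 0ℚ ≤ℚ b s i
      b-vanishes      : ∀ i → n < i → b s i ≡ 0ℚ
      D-bounded       : D s ≤ℚ ratio * dualNorm N h (a s) (b s) - sumS s

  open Invariant

  initial : Invariant 0 (initState k)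
  initial .S-bounded q = ℕ.≤-reflexive (Vec.lookup-replicate q 0)
  initial .minus-bounded q = z≤n
  initial .S-distinct p q _ = inj₁ (Vec.lookup-replicate p 0)
  initial .b-nonneg i = ℚ.≤-refl
  initial .b-vanishes i _ = refl
  initial .D-bounded = ℚ.≤-reflexive (sym (begin
      ratio * dualNorm N h (λ _ → 0ℚ) (λ _ → 0ℚ) - sumᵛ (λ _ → 0ℚ) (replicate k 0)
    ≡⟨ cong₂ (λ t u → ratio * (((0ℚ - fromℕ h * 0ℚ) - t) + u) - sumᵛ (λ _ → 0ℚ) (replicate k 0))
             (sumℚ-zeros (upTo (N ∸ 1))) (sumℚ-zeros (upTo N)) ⟩
      ratio * (((0ℚ - fromℕ h * 0ℚ) - 0ℚ) + 0ℚ) - sumᵛ (λ _ → 0ℚ) (replicate k 0)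
    ≡⟨ cong (ratio * (((0ℚ - fromℕ h * 0ℚ) - 0ℚ) + 0ℚ) -_) (sumᵛ-zeros (replicate k 0)) ⟩
      ratio * (((0ℚ - fromℕ h * 0ℚ) - 0ℚ) + 0ℚ) - 0ℚ
    ≡⟨ solve 2 (λ c h → c :* (((con 0ℚ :- h :* con 0ℚ) :- con 0ℚ) :+ con 0ℚ) :- con 0ℚ := con 0ℚ)
             refl ratio (fromℕ h) ⟩
      0ℚ
    ∎))
    where open ≡-Reasoning

  module Serve {n} {s : State k} (I : Invariant n s) (p : Fin k) where

    S′ : Vec ℕ k
    S′ = S s [ p ]≔ suc n

    setMinus-on-S : ∀ v q → setMinus (minus s) (suc n) v (lookup (S s) q) ≡ minus s (lookup (S s) q)
    setMinus-on-S v q = setMinus-there (minus s) v (s≤s (S-bounded I q))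

    minus-bounded′ : ∀ {v} → v ≤ suc n → ∀ q → setMinus (minus s) (suc n) v (lookup S′ q) ≤ suc n
    minus-bounded′ {v} v≤ q with lookup-[]≔ (S s) p (suc n) q
    ... | inj₁ (_ , eq) rewrite eq | setMinus-here (minus s) (suc n) v = v≤
    ... | inj₂ eq rewrite eq | setMinus-on-S v q = ℕ.m≤n⇒m≤1+n (minus-bounded I q)

    b⁻-raised : ∀ δ v q → raiseB (suc n) δ (b s) (suc (setMinus (minus s) (suc n) v (lookup (S s) q)))
                          ≡ b⁻ s (lookup (S s) q) + δ
    b⁻-raised δ v q rewrite setMinus-on-S v q =
      raiseB-raised (suc n) δ (b s) (s≤s z≤n) (s≤s (minus-bounded I q))

  stay-preserves : ∀ {n s} p → Invariant n s →
    Invariant (suc n) (st (a s) (b s) (S s [ p ]≔ suc n)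
                          (setMinus (minus s) (suc n) (minus s (lookup (S s) p))) (D s))
  stay-preserves {n} {s} p I = record
    { S-bounded = []≔-fresh-bounded (S s) p (S-bounded I)
    ; minus-bounded = minus-bounded′ (ℕ.m≤n⇒m≤1+n (minus-bounded I p))
    ; S-distinct = []≔-fresh-nonzeroDistinct (S s) p (S-bounded I) (S-distinct I)
    ; b-nonneg = b-nonneg I
    ; b-vanishes = λ i n+1<i → b-vanishes I i (ℕ.<-trans (ℕ.n<1+n n) n+1<i)
    ; D-bounded = subst (λ t → D s ≤ℚ ratio * dualNorm N h (a s) (b s) - t) (sym sum-unchanged) (D-bounded I)
    }
    where
    open Serve I p
    v = minus s (lookup (S s) p)
    b⁻′ : ℕ → ℚ
    b⁻′ i = b s (suc (setMinus (minus s) (suc n) v i))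
    sum-unchanged : sumᵛ b⁻′ S′ ≡ sumS s
    sum-unchanged = begin
      sumᵛ b⁻′ S′                                                  ≡⟨ sumᵛ-[]≔ b⁻′ (S s) p (suc n) ⟩
      (sumᵛ b⁻′ (S s) - b⁻′ (lookup (S s) p)) + b⁻′ (suc n)
        ≡⟨ cong₂ (λ t u → (t - b⁻′ (lookup (S s) p)) + b s (suc u))
                 (sumᵛ-cong {f = b⁻′} {b⁻ s} (S s) (λ q → cong (λ m → b s (suc m)) (setMinus-on-S v q)))
                 (setMinus-here (minus s) (suc n) v) ⟩
      (sumS s - b⁻′ (lookup (S s) p)) + b⁻ s (lookup (S s) p)
        ≡⟨ cong (λ m → (sumS s - b s (suc m)) + b⁻ s (lookup (S s) p)) (setMinus-on-S v p) ⟩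
      (sumS s - b⁻ s (lookup (S s) p)) + b⁻ s (lookup (S s) p)
        ≡⟨ solve 2 (λ σ g → (σ :- g) :+ g := σ) refl (sumS s) (b⁻ s (lookup (S s) p)) ⟩
      sumS s                                                       ∎
      where open ≡-Reasoning

  relabel-stalls : ∀ {n s} δ → 0ℚ ≤ℚ δ → Invariant n s →
    (∀ q → raiseB (suc n) δ (b s) (suc (lookup (S s) q)) ≤ℚ w (r (lookup (S s) q))) →
    T (memᵇ 0 (S s)) → δ ≡ 0ℚ
  relabel-stalls {n} {s} δ 0≤δ I below r₀∈S with memᵇ-sound 0 (S s) r₀∈S
  ... | q , Sq≡0 = ℚ.≤-antisym δ≤0 0≤δ
    where
    b₁+δ≤0 : b s 1 + δ ≤ℚ 0ℚ
    b₁+δ≤0 = subst₂ _≤ℚ_ (raiseB-raised (suc n) δ (b s) (s≤s z≤n) (s≤s z≤n)) w-r₀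
               (subst (λ i → raiseB (suc n) δ (b s) (suc i) ≤ℚ w (r i)) Sq≡0 (below q))
    δ≤0 : δ ≤ℚ 0ℚ
    δ≤0 = ℚ.≤-trans (subst (_≤ℚ b s 1 + δ) (ℚ.+-identityˡ δ) (ℚ.+-monoˡ-≤ δ (b-nonneg I 1))) b₁+δ≤0

  relabel-gain : ∀ {n s} δ → 0ℚ ≤ℚ δ → suc n ≤ N → Invariant n s →
    (∀ q → raiseB (suc n) δ (b s) (suc (lookup (S s) q)) ≤ℚ w (r (lookup (S s) q))) →
    ratio * (dualNormSlope N h (suc n) (S s) * δ) ≡ fromℕ k * δ
  relabel-gain {n} {s} δ 0≤δ n<N I below with T? (memᵇ 0 (S s))
  ... | yes r₀∈S rewrite relabel-stalls δ 0≤δ I below r₀∈S =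
    trans (cong (ratio *_) (ℚ.*-zeroʳ (dualNormSlope N h (suc n) (S s))))
          (trans (ℚ.*-zeroʳ ratio) (sym (ℚ.*-zeroʳ (fromℕ k))))
  ... | no r₀∉S = begin
      ratio * (dualNormSlope N h (suc n) (S s) * δ)  ≡⟨ ℚ.*-assoc ratio _ δ ⟨
      (ratio * dualNormSlope N h (suc n) (S s)) * δ
        ≡⟨ cong (λ t → (ratio * t) * δ) (dualNormSlope-unserved h≤k n<N (S s) positive (S-bounded I) injective) ⟩
      (ratio * fromℕ (suc (k ∸ h))) * δ              ≡⟨ cong (_* δ) (n/d*d≡n k (k ∸ h)) ⟩
      fromℕ k * δ                                    ∎
    where
    open ≡-Reasoning
    positive : ∀ q → 0 < lookup (S s) q
    positive q with lookup (S s) q | memᵇ-lookup (S s) q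
    ... | zero  | r₀∈S = ⊥-elim (r₀∉S r₀∈S)
    ... | suc _ | _    = s≤s z≤n
    injective : Injective _≡_ _≡_ (lookup (S s))
    injective {q₁} {q₂} eq with S-distinct I q₁ q₂ eq
    ... | inj₁ Sq≡0 = ⊥-elim (ℕ.<-irrefl (sym Sq≡0) (positive q₁))
    ... | inj₂ q₁≡q₂ = q₁≡q₂

  move-preserves : ∀ {n s} δ → 0ℚ ≤ℚ δ → suc n ≤ N →
    (∀ q → raiseB (suc n) δ (b s) (suc (lookup (S s) q)) ≤ℚ w (r (lookup (S s) q))) →
    ∀ p → w (r (lookup (S s) p)) ≤ℚ raiseB (suc n) δ (b s) (suc (minus s (lookup (S s) p))) →
    Invariant n s →
    Invariant (suc n) (st (raiseA (suc n) (S s) δ (a s)) (raiseB (suc n) δ (b s)) (S s [ p ]≔ suc n)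
                          (setMinus (minus s) (suc n) (suc n)) (D s + w (r (lookup (S s) p))))
  move-preserves {n} {s} δ 0≤δ n<N below p w≤b I = record
    { S-bounded = []≔-fresh-bounded (S s) p (S-bounded I)
    ; minus-bounded = minus-bounded′ ℕ.≤-refl
    ; S-distinct = []≔-fresh-nonzeroDistinct (S s) p (S-bounded I) (S-distinct I)
    ; b-nonneg = raiseB-nonneg (suc n) 0≤δ (b-nonneg I)
    ; b-vanishes = λ i n+1<i →
        trans (raiseB-beyond (suc n) δ (b s) n+1<i) (b-vanishes I i (ℕ.<-trans (ℕ.n<1+n n) n+1<i))
    ; D-bounded = subst (D s + w (r (lookup (S s) p)) ≤ℚ_) (sym rhs-grows) (ℚ.+-mono-≤ (D-bounded I) w≤G+δ)
    }
    where
    open Serve I p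
    G = b⁻ s (lookup (S s) p)
    b⁻′ : ℕ → ℚ
    b⁻′ i = raiseB (suc n) δ (b s) (suc (setMinus (minus s) (suc n) (suc n) i))
    w≤G+δ : w (r (lookup (S s) p)) ≤ℚ G + δ
    w≤G+δ = subst (w (r (lookup (S s) p)) ≤ℚ_)
                  (raiseB-raised (suc n) δ (b s) (s≤s z≤n) (s≤s (minus-bounded I p))) w≤b
    fresh-summand : b⁻′ (suc n) ≡ 0ℚ
    fresh-summand rewrite setMinus-here (minus s) (suc n) (suc n) =
      trans (raiseB-beyond (suc n) δ (b s) (ℕ.n<1+n (suc n))) (b-vanishes I (suc (suc n)) (ℕ.n≤1+n (suc n)))
    sum-after : sumᵛ b⁻′ S′ ≡ ((sumS s + fromℕ k * δ) - (G + δ)) + 0ℚ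
    sum-after = begin
      sumᵛ b⁻′ S′                                                 ≡⟨ sumᵛ-[]≔ b⁻′ (S s) p (suc n) ⟩
      (sumᵛ b⁻′ (S s) - b⁻′ (lookup (S s) p)) + b⁻′ (suc n)
        ≡⟨ cong₂ (λ t u → (t - u) + b⁻′ (suc n))
                 (sumᵛ-cong {f = b⁻′} {λ i → b⁻ s i + δ} (S s) (b⁻-raised δ (suc n)))
                 (b⁻-raised δ (suc n) p) ⟩
      (sumᵛ (λ i → b⁻ s i + δ) (S s) - (G + δ)) + b⁻′ (suc n)
        ≡⟨ cong₂ (λ t u → (t - (G + δ)) + u) (sumᵛ-+δ (b⁻ s) δ (S s)) fresh-summand ⟩
      ((sumS s + fromℕ k * δ) - (G + δ)) + 0ℚ                      ∎
      where open ≡-Reasoning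
    rhs-grows : ratio * dualNorm N h (raiseA (suc n) (S s) δ (a s)) (raiseB (suc n) δ (b s)) - sumᵛ b⁻′ S′
                ≡ (ratio * dualNorm N h (a s) (b s) - sumS s) + (G + δ)
    rhs-grows =
      trans (cong₂ (λ ν σ → ratio * ν - σ) (dualNorm-raise N h (suc n) (S s) δ (a s) (b s)) sum-after)
            (rhs-after-move ratio (dualNorm N h (a s) (b s)) (sumS s) (G + δ)
                            (relabel-gain δ 0≤δ n<N I below))

  step-preserves : ∀ {n s s′} → suc n ≤ N → Invariant n s → Step w r k (suc n) s s′ → Invariant (suc n) s′
  step-preserves _ I (stay p _) = stay-preserves p I
  step-preserves n<N I (relabelMove _ δ 0≤δ below _ p w≤b) = move-preserves δ 0≤δ n<N below p w≤b I

  run-invariant : ∀ {n s} → n ≤ N → Run w r k n s → Invariant n s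
  run-invariant _ init = initial
  run-invariant n≤N (next run step) =
    step-preserves n≤N (run-invariant (ℕ.≤-trans (ℕ.n≤1+n _) n≤N) run) step

mainTheorem3 : {V : Set} (w : V → ℚ) → (∀ v → 0ℚ ≤ℚ w v) →
    (N : ℕ) (r : ℕ → V) → w (r 0) ≡ 0ℚ → (∀ j → 1 ≤ j → j ≤ N → r j ≢ r 0) →
    (k : ℕ) → 1 ≤ k → (h : ℕ) → 1 ≤ h → h ≤ k →
    (n : ℕ) → n ≤ N → (s : State k) → Run w r k n s →
    D s ≤ℚ ((+ k / suc (k ∸ h)) * dualNorm N h (a s) (b s) - sumS s)
mainTheorem3 w _ N r w-r₀ _ k _ h _ h≤k n n≤N s run = Invariant.D-bounded (run-invariant n≤N run)
  where open GreedyDual w r w-r₀ N k h h≤k
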